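{- Let $x\in\{0,1\}^w$ and let $p$ be a prefix of $x$ such that $p\in\mathrm{Pref}(S)$ and $|p|>w-\log D(x,S)$. Then either $x\le y$ for every $y\in S$ having $p$ as a prefix, or $x>y$ for every $y\in S$ having $p$ as a prefix.
   Context: Let $S$ be a nonempty set of binary strings of length $w$, identified with integers in $[0,2^w)$ so that lexicographic and numeric order coincide. $\mathrm{Pref}(S)$ is the set of prefixes of elements of $S$. For $x$, $x^-=\max\{y\in S\mid y<x\}$, $x^+=\min\{y\in S\mid y\ge x\}$, and $D(x,S)=\max\{x^+-x,\,x-x^-\}$; if only one of $x^\pm$ exists, $D(x,S)$ is the distance from $x$ to that one. Logarithms are binary, with $\log z=1$ whenever $z<2$. -}

module Defs where

open import Data.Nat using (ℕ; zero; suc; _+_; _*_; _∸_; _^_; _≤_; _<_; _⊔_; _⊓_; _<?_; _≤?_)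
open import Data.Nat.Properties using (m^n≢0)
open import Data.Nat.DivMod using (_/_)
open import Data.List using (List; []; _∷_; filter; foldr)
open import Data.Product using (_×_)
open import Data.Sum using (_⊎_)
open import Relation.Binary.PropositionalEquality using (_≡_)

-- Binary strings of length w are identified with naturals in [0, 2^w).
-- The prefix of length l (l ≤ w) of a string y is y / 2^(w ∸ l).
prefix : (w l y : ℕ) → ℕ
prefix w l y = _/_ y (2 ^ (w ∸ l)) {{m^n≢0 2 (w ∸ l)}}

maxL : ℕ → List ℕ → ℕ
maxL m ms = foldr _⊔_ m ms

minL : ℕ → List ℕ → ℕ
minL m ms = foldr _⊓_ m ms

-- D(x,S) = max{x⁺ - x, x - x⁻}, with x⁻ = max{y ∈ S | y < x}, x⁺ = min{y ∈ S | y ≥ x};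
-- if only one of x^± exists, the distance to that one (0 if neither, impossible for S ≠ ∅).
D : ℕ → List ℕ → ℕ
D x S with filter (_<? x) S | filter (x ≤?_) S
... | []     | []     = 0
... | []     | s ∷ ss = minL s ss ∸ x
... | m ∷ ms | []     = x ∸ maxL m ms
... | m ∷ ms | s ∷ ss = (minL s ss ∸ x) ⊔ (x ∸ maxL m ms)

-- k <log z  means  k < log z  (real binary log, with log z = 1 whenever z < 2).
-- For z ≥ 2: k < log₂ z  ⇔  2^k < z.   For z < 2: k < 1 ⇔ k ≡ 0.
_<log_ : ℕ → ℕ → Set
k <log z = (z < 2 × k ≡ 0) ⊎ (2 ≤ z × 2 ^ k < z)

module Submission where

-- If the conclusion failed, S would contain y₁ < x ≤ y₂ with the same l-bit prefix as x.
-- All three then lie in one block of 2^(w ∸ l) consecutive integers, so both x ∸ x⁻ ≤ x ∸ y₁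
-- and x⁺ ∸ x ≤ y₂ ∸ x are below 2^(w ∸ l), i.e. D(x,S) < 2^(w ∸ l), contradicting w ∸ l < log D(x,S).
-- (When w ∸ l = 0 the blocks are singletons and y₁ < x already fails.)

open import Defs
open import Data.Nat using (ℕ; _∸_; _^_; _≤_; _<_; _+_; _*_; NonZero; _≟_; _<?_; _≤?_)
open import Data.Nat.Properties
open import Data.Nat.DivMod using (_/_; _%_; m≡m%n+[m/n]*n; m%n<n; m/n*n≤m)
open import Data.List using (List; []; _∷_; filter)
open import Data.List.Membership.Propositional using (_∈_; find; lose)
open import Data.List.Membership.Propositional.Properties using (∈-filter⁺)
open import Data.List.Relation.Unary.Any using (here; there; any?)
open import Data.List.Relation.Unary.All using (All)
open import Data.Product using (Σ; _×_; _,_)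
open import Data.Sum using (_⊎_; inj₁; inj₂)
open import Data.Empty using (⊥-elim)
open import Relation.Nullary using (yes; no; _×-dec_)
open import Relation.Binary.PropositionalEquality using (_≡_; _≢_; refl; sym; cong; subst)

m/n≡o/n⇒o<m+n : ∀ m n o .{{_ : NonZero n}} → m / n ≡ o / n → o < m + n
m/n≡o/n⇒o<m+n m n o eq = begin-strict
  o                   ≡⟨ m≡m%n+[m/n]*n o n ⟩
  o % n + (o / n) * n <⟨ +-monoˡ-< ((o / n) * n) (m%n<n o n) ⟩
  n + (o / n) * n     ≡⟨ cong (λ q → n + q * n) (sym eq) ⟩
  n + (m / n) * n     ≤⟨ +-monoʳ-≤ n (m/n*n≤m m n) ⟩
  n + m               ≡⟨ +-comm n m ⟩
  m + n               ∎
  where open ≤-Reasoning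

prefix-≡⇒∸<2^ : ∀ w l y x → prefix w l y ≡ prefix w l x → x ∸ y < 2 ^ (w ∸ l)
prefix-≡⇒∸<2^ w l y x eq =
  m<n+o⇒m∸n<o x y {{m^n≢0 2 (w ∸ l)}} (m/n≡o/n⇒o<m+n y (2 ^ (w ∸ l)) x {{m^n≢0 2 (w ∸ l)}} eq)

∈⇒≤maxL : ∀ m ms {y} → y ∈ m ∷ ms → y ≤ maxL m ms
∈⇒≤maxL m []       (here refl)         = ≤-refl
∈⇒≤maxL m (n ∷ ns) (here refl)         = m≤n⇒m≤o⊔n n (∈⇒≤maxL m ns (here refl))
∈⇒≤maxL m (n ∷ ns) (there (here refl)) = m≤m⊔n n (maxL m ns)
∈⇒≤maxL m (n ∷ ns) (there (there y∈)) = m≤n⇒m≤o⊔n n (∈⇒≤maxL m ns (there y∈))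

∈⇒minL≤ : ∀ m ms {y} → y ∈ m ∷ ms → minL m ms ≤ y
∈⇒minL≤ m []       (here refl)         = ≤-refl
∈⇒minL≤ m (n ∷ ns) (here refl)         = m≤n⇒o⊓m≤n n (∈⇒minL≤ m ns (here refl))
∈⇒minL≤ m (n ∷ ns) (there (here refl)) = m⊓n≤m n (minL m ns)
∈⇒minL≤ m (n ∷ ns) (there (there y∈)) = m≤n⇒o⊓m≤n n (∈⇒minL≤ m ns (there y∈))

D<-filtered : ∀ {x y₁ y₂ B} S → y₁ ∈ filter (_<? x) S → y₂ ∈ filter (x ≤?_) S →
              x ∸ y₁ < B → y₂ ∸ x < B → D x S < B
D<-filtered {x} S y₁∈ y₂∈ below above with filter (_<? x) S | filter (x ≤?_) S
... | m ∷ ms | n ∷ ns = ⊔-pres-<m (≤-<-trans (∸-monoˡ-≤ x (∈⇒minL≤ n ns y₂∈)) above)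
                                  (≤-<-trans (∸-monoʳ-≤ x (∈⇒≤maxL m ms y₁∈)) below)

D< : ∀ {x y₁ y₂ B} S → y₁ ∈ S → y₂ ∈ S → y₁ < x → x ≤ y₂ →
     x ∸ y₁ < B → y₂ ∸ x < B → D x S < B
D< S y₁∈S y₂∈S y₁<x x≤y₂ =
  D<-filtered S (∈-filter⁺ (_<? _) y₁∈S y₁<x) (∈-filter⁺ (_ ≤?_) y₂∈S x≤y₂)

<log∧<2^⇒≡0 : ∀ {k z} → k <log z → z < 2 ^ k → k ≡ 0
<log∧<2^⇒≡0 (inj₁ (_ , k≡0))    _   = k≡0
<log∧<2^⇒≡0 (inj₂ (_ , 2^k<z)) z<2^k = ⊥-elim (<-asym 2^k<z z<2^k)

lemma3 : (w : ℕ) (S : List ℕ) → S ≢ [] → All (λ y → y < 2 ^ w) S →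
    (x : ℕ) → x < 2 ^ w →
    (l : ℕ) → l ≤ w →
    Σ ℕ (λ y → y ∈ S × prefix w l y ≡ prefix w l x) →
    (w ∸ l) <log D x S →
    ((y : ℕ) → y ∈ S → prefix w l y ≡ prefix w l x → x ≤ y)
    ⊎ ((y : ℕ) → y ∈ S → prefix w l y ≡ prefix w l x → y < x)
lemma3 w S _ _ x _ l _ _ w∸l<logD
  with any? (λ y → (prefix w l y ≟ prefix w l x) ×-dec (y <? x)) S
... | no noneBelow = inj₁ λ y y∈S eq → ≮⇒≥ λ y<x → noneBelow (lose y∈S (eq , y<x))
... | yes someBelow with find someBelow
...   | y₁ , y₁∈S , eq₁ , y₁<x = inj₂ λ y₂ y₂∈S eq₂ → ≰⇒> λ x≤y₂ →
  let below : x ∸ y₁ < 2 ^ (w ∸ l)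
      below = prefix-≡⇒∸<2^ w l y₁ x eq₁
      w∸l≡0 : w ∸ l ≡ 0
      w∸l≡0 = <log∧<2^⇒≡0 w∸l<logD
                (D< S y₁∈S y₂∈S y₁<x x≤y₂ below (prefix-≡⇒∸<2^ w l x y₂ (sym eq₂)))
  in <⇒≱ (m<n⇒0<n∸m y₁<x) (m<1+n⇒m≤n (subst (λ k → x ∸ y₁ < 2 ^ k) w∸l≡0 below))
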